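{- Let $G$ be an arbitrary finite graph, and let $G^*$ be the graph obtained from $G$ by taking, for each vertex $v\in V(G)$, a new path of order $7$ (these paths pairwise vertex-disjoint and disjoint from $G$) and identifying $v$ with the center vertex of that path. Then $\iota_{\rm g}(G^*)=\iota_{\rm g}'(G^*)=\frac{3}{7}n(G^*)$, where $n(G^*)$ is the order of $G^*$.
   Context: All graphs are finite and simple; $N[S]$ denotes the closed neighborhood of a vertex set $S$. In the isolation game on a graph $G$, Dominator and Staller alternately choose vertices; if $S$ is the set of already chosen vertices, a vertex $x$ may be chosen only if it equals or is adjacent to some vertex $y$ lying in a component of $G-N[S]$ that has at least one edge. The game ends when no such vertex exists. Dominator wants to minimize the number of chosen vertices, Staller wants to maximize it. $\iota_{\rm g}(G)$ (resp. $\iota_{\rm g}'(G)$) is the number of chosen vertices under optimal play when Dominator (resp. Staller) moves first. -}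

module Defs where

open import Data.Nat using (ℕ; zero; suc; _*_; _≤_)
open import Data.Fin using (Fin; toℕ; quotient; remainder)
open import Data.List using (List; []; _∷_)
open import Data.List.Membership.Propositional using (_∈_)
open import Data.Product using (Σ; ∃; ∃-syntax; _×_; _,_)
open import Data.Sum using (_⊎_; inj₁; inj₂; swap)
open import Data.Empty using (⊥)
open import Relation.Nullary using (¬_)
open import Relation.Binary.PropositionalEquality using (_≡_; refl; sym)

record Graph : Set₁ where
  field
    order  : ℕ
    Adj    : Fin order → Fin order → Set
    sym'   : ∀ {u v} → Adj u v → Adj v u
    irrefl : ∀ {u} → ¬ Adj u u

open Graph public

module _ (G : Graph) where
  private
    V = Fin (order G)

  InClosedNbhd : List V → V → Set
  InClosedNbhd S u = ∃[ s ] (s ∈ S × (s ≡ u ⊎ Adj G s u))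

  Free : List V → V → Set
  Free S u = ¬ InClosedNbhd S u

  -- Reach S y u : u lies in the same component of G - N[S] as y
  -- (walk from y to u through vertices of G - N[S]; y itself is
  -- required to be free separately)
  data Reach (S : List V) (y : V) : V → Set where
    here : Reach S y y
    step : ∀ {u w} → Reach S y u → Free S w → Adj G u w → Reach S y w

  InNontrivialComponent : List V → V → Set
  InNontrivialComponent S y =
    Free S y × ∃[ u ] ∃[ w ] (Reach S y u × Reach S y w × Adj G u w)

  Legal : List V → V → Set
  Legal S x = ∃[ y ] (InNontrivialComponent S y × (x ≡ y ⊎ Adj G x y))

  GameOver : List V → Set
  GameOver S = ∀ x → ¬ Legal S x

  -- UpperD S k : Dominator is to move in position S and Dominator can
  -- guarantee that at most k further vertices are chosen.
  -- UpperS S k : the same, with Staller to move.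
  data UpperD (S : List V) : ℕ → Set
  data UpperS (S : List V) : ℕ → Set

  data UpperD S where
    endD  : ∀ {k} → GameOver S → UpperD S k
    moveD : ∀ {k} (x : V) → Legal S x → UpperS (x ∷ S) k → UpperD S (suc k)

  data UpperS S where
    endS  : ∀ {k} → GameOver S → UpperS S k
    moveS : ∀ {k} → (∀ x → Legal S x → UpperD (x ∷ S) k) → UpperS S (suc k)

  IsIotaG : ℕ → Set
  IsIotaG k = UpperD [] k × (∀ j → UpperD [] j → k ≤ j)

  IsIotaG' : ℕ → Set
  IsIotaG' k = UpperS [] k × (∀ j → UpperS [] j → k ≤ j)

-- Vertex a of G* ∈ Fin (n * 7) is the pair (quotient a , remainder a) =
-- (v , i), meaning position i (0..6) of the path attached to v; position 3
-- (the center) is the vertex v of G itself.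

PathAdj : Fin 7 → Fin 7 → Set
PathAdj i j = suc (toℕ i) ≡ toℕ j ⊎ suc (toℕ j) ≡ toℕ i

baseV : (G : Graph) → Fin (order G * 7) → Fin (order G)
baseV G a = quotient {order G} 7 a

pos : (G : Graph) → Fin (order G * 7) → Fin 7
pos G a = remainder {order G} 7 a

StarAdj : (G : Graph) → Fin (order G * 7) → Fin (order G * 7) → Set
StarAdj G a b =
  (baseV G a ≡ baseV G b × PathAdj (pos G a) (pos G b))
  ⊎ (toℕ (pos G a) ≡ 3 × toℕ (pos G b) ≡ 3 × Adj G (baseV G a) (baseV G b))

private
  n≢1+n : ∀ {n} → ¬ suc n ≡ n
  n≢1+n ()

  starSym : (G : Graph) → ∀ {a b} → StarAdj G a b → StarAdj G b a
  starSym G (inj₁ (e , p)) = inj₁ (sym e , swap p)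
  starSym G (inj₂ (p , q , r)) = inj₂ (q , p , sym' G r)

  starIrr : (G : Graph) → ∀ {a} → ¬ StarAdj G a a
  starIrr G (inj₁ (_ , inj₁ e)) = n≢1+n e
  starIrr G (inj₁ (_ , inj₂ e)) = n≢1+n e
  starIrr G (inj₂ (_ , _ , r)) = irrefl G r

Star : Graph → Graph
Star G = record
  { order  = order G * 7
  ; Adj    = StarAdj G
  ; sym'   = starSym G
  ; irrefl = starIrr G
  }

-- A position is measured by the potential Σ_v (3 ∸ number of chosen vertices on the path of v),
-- which is 3n = (3/7)·n(G*) at the start.  After each of his moves Dominator has every path Good,
-- if necessary by answering on the path Staller has just played: every legal move then lowers the
-- potential, and once no Good-preserving move is left every path is Closed and the game is over,
-- so at most 3n vertices are chosen.
-- Staller keeps every path with fewer than three chosen vertices OneSided (not meeting both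
-- {0,1,2} and {4,5,6}): while the potential is positive this leaves her a legal move, a Dominator
-- move that spoils it is repaired by taking the centre, and no move lowers the potential by more
-- than one, so at least 3n vertices are chosen.  Legality in G* is controlled by a single path:
-- Robust is sufficient and Possible necessary, whatever is played on the other paths, so every
-- fact about one path ranges over its 2⁷ configurations and is decided by evaluation.

module Submission where

open import Defs
open import Algebra.Properties.CommutativeMonoid.Sum as ℕSum using ()
open import Data.Fin using (Fin; toℕ; #_; combine; punchIn; _≟_)
open import Data.Fin.Properties using (any?; all?; toℕ-injective; remQuot-combine; combine-remQuot; punchInᵢ≢i)
open import Data.Fin.Subset using (Subset; _∈_; _∉_; ⁅_⁆; _∪_; ∣_∣; ⊥)
open import Data.Fin.Subset.Properties using (_∈?_; anySubset?; ∉⊥; x∈⁅x⁆; x∈⁅y⁆⇒x≡y; x∈p∪q⁻; x∈p∪q⁺)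
open import Data.List using (List; []; _∷_)
open import Data.List.Membership.Propositional using () renaming (_∈_ to _∈ₗ_)
open import Data.List.Relation.Unary.Any using (here; there)
open import Data.Nat as ℕ using (ℕ; zero; suc; _+_; _*_; _∸_; _≤_; _<_; z≤n; s≤s)
open import Data.Nat.Properties using (+-0-commutativeMonoid; +-monoˡ-≤; +-monoˡ-<; ≤-trans; <-≤-trans; ≤-reflexive; ≤-pred; ≮⇒≥; n≮0; m≤n⇒m∸n≡0; *-zeroʳ)
open import Data.Nat.Tactic.RingSolver using (solve-∀)
open import Data.Product using (∃; ∃-syntax; _×_; _,_; proj₁; proj₂; map₁; map₂)
open import Data.Sum using (_⊎_; inj₁; inj₂; [_,_])
open import Data.Vec.Functional using (Vector; removeAt)
open import Function using (_∘_)
open import Relation.Nullary using (¬_; Dec; yes; no; contradiction)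
open import Relation.Nullary.Decidable using (_×-dec_; _⊎-dec_; _→-dec_; ¬?; map′; decidable-stable; from-yes)
open import Relation.Unary using (Pred; Decidable)
open import Relation.Binary.PropositionalEquality using (_≡_; _≢_; refl; sym; trans; cong; cong₂; subst; subst₂)

open ℕSum +-0-commutativeMonoid using (sum; sum-remove; sum-cong-≗)

allSubset? : ∀ {n ℓ} {P : Pred (Subset n) ℓ} → Decidable P → Dec (∀ t → P t)
allSubset? P? = map′ (λ ∄¬P t → decidable-stable (P? t) (λ ¬Pt → ∄¬P (t , ¬Pt)))
                     (λ ∀P (t , ¬Pt) → ¬Pt (∀P t))
                     (¬? (anySubset? (¬? ∘ P?)))

∀≢⇒∀ : ∀ {n p} {P : Fin n → Set p} w → (∀ v → v ≢ w → P v) → P w → ∀ v → P v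
∀≢⇒∀ w P≢ Pw v with v ≟ w
... | yes refl = Pw
... | no v≢w = P≢ v v≢w

sum-const : ∀ m k → sum {m} (λ _ → k) ≡ m * k
sum-const zero    k = refl
sum-const (suc m) k = cong (k +_) (sum-const m k)

sum-zero : ∀ {m} (f : Vector ℕ m) → (∀ v → f v ≡ 0) → sum f ≡ 0
sum-zero {m} f f≗0 = trans (sum-cong-≗ f≗0) (trans (sum-const m 0) (*-zeroʳ m))

sum-split-at : ∀ {m} (f g : Vector ℕ m) w → (∀ v → v ≢ w → f v ≡ g v) →
               ∃ λ r → sum f ≡ f w + r × sum g ≡ g w + r
sum-split-at {suc m} f g w f≡g =
  sum (removeAt g w) ,
  trans (sum-remove f) (cong (f w +_) (sum-cong-≗ λ j → f≡g (punchIn w j) (punchInᵢ≢i w j))) ,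
  sum-remove g

sum-<-at : ∀ {m} {f g : Vector ℕ m} w → (∀ v → v ≢ w → f v ≡ g v) →
           f w < g w → sum f < sum g
sum-<-at {f = f} {g} w f≡g fw<gw with sum-split-at f g w f≡g
... | r , sum-f , sum-g = subst₂ _<_ (sym sum-f) (sym sum-g) (+-monoˡ-< r fw<gw)

sum-≤-suc-at : ∀ {m} {f g : Vector ℕ m} w → (∀ v → v ≢ w → f v ≡ g v) →
               g w ≤ suc (f w) → sum g ≤ suc (sum f)
sum-≤-suc-at {f = f} {g} w f≡g gw≤ with sum-split-at f g w f≡g
... | r , sum-f , sum-g = subst₂ _≤_ (sym sum-g) (cong suc (sym sum-f)) (+-monoˡ-≤ r gw≤)

module _ (H : Graph) {S : List (Fin (order H))} where

  reach-start-or-step : ∀ {y u} → Reach H S y u → u ≡ y ⊎ ∃ λ w → Free H S w × Adj H y w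
  reach-start-or-step here = inj₁ refl
  reach-start-or-step (step r free-w u~w) with reach-start-or-step r
  ... | inj₁ refl = inj₂ (_ , free-w , u~w)
  ... | inj₂ first = inj₂ first

  nontrivial⇒freeNeighbour : ∀ {y} → InNontrivialComponent H S y → ∃ λ u → Free H S u × Adj H y u
  nontrivial⇒freeNeighbour (_ , u , w , reach-u , reach-w , u~w)
    with reach-start-or-step reach-u | reach-start-or-step reach-w
  ... | inj₂ first | _        = first
  ... | inj₁ refl | inj₂ first = first
  ... | inj₁ refl | inj₁ refl = contradiction u~w (irrefl H)

  legal⇒unchosen : ∀ {x} → Legal H S x → ¬ x ∈ₗ S
  legal⇒unchosen (y , (free-y , _) , x≈y) x∈S = free-y (_ , x∈S , x≈y)

centre : Fin 7
centre = # 3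

Dominated : Subset 7 → Fin 7 → Set
Dominated t i = ∃ λ j → j ∈ t × (j ≡ i ⊎ PathAdj j i)

Undominated : Subset 7 → Fin 7 → Set
Undominated t i = ¬ Dominated t i

-- Only the centre of a path can be dominated from outside the path.
FreeOffCentre : Subset 7 → Fin 7 → Set
FreeOffCentre t i = i ≢ centre × Undominated t i

HasFreeEdge : Pred (Fin 7) _ → Fin 7 → Set
HasFreeEdge F z = F z × ∃ λ u → PathAdj z u × F u

LegalWithin : Pred (Fin 7) _ → Fin 7 → Set
LegalWithin F x = ∃ λ z → (x ≡ z ⊎ PathAdj x z) × HasFreeEdge F z

Robust : Subset 7 → Fin 7 → Set
Robust t = LegalWithin (FreeOffCentre t)

-- The ways a vertex i of a path can be legal: the witnessing free edge lies on the path, or i is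
-- the centre, or the witness is the free centre next to i with its free neighbour on another path.
Witnessable : Subset 7 → Fin 7 → Set
Witnessable t i = LegalWithin (Undominated t) i ⊎ i ≡ centre ⊎ PathAdj i centre × Undominated t centre

Possible : Subset 7 → Fin 7 → Set
Possible t i = i ∉ t × Witnessable t i

Closed : Subset 7 → Set
Closed t = Dominated t centre × ¬ ∃ (HasFreeEdge (Undominated t))

MeetsLeft : Subset 7 → Set
MeetsLeft t = ∃ λ i → i ∈ t × toℕ i < 3

MeetsRight : Subset 7 → Set
MeetsRight t = ∃ λ i → i ∈ t × 3 < toℕ i

Good : Subset 7 → Set
Good t = ∣ t ∣ ≡ 0
  ⊎ ∣ t ∣ ≡ 1 × Dominated t centre
  ⊎ ∣ t ∣ ≡ 2 × (centre ∈ t ⊎ Dominated t centre × MeetsLeft t × MeetsRight t)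
  ⊎ ∣ t ∣ ≡ 3 × centre ∈ t × MeetsLeft t × MeetsRight t

OneSided : Subset 7 → Set
OneSided t = 3 ≤ ∣ t ∣
  ⊎ ∣ t ∣ ≡ 2 × ¬ (MeetsLeft t × MeetsRight t)
  ⊎ ∣ t ∣ ≤ 1 × ¬ MeetsLeft t × ¬ MeetsRight t

add : Fin 7 → Subset 7 → Subset 7
add i t = ⁅ i ⁆ ∪ t

deficit : Subset 7 → ℕ
deficit t = 3 ∸ ∣ t ∣

Spare : Subset 7 → Set
Spare t = ∃ λ x → Robust t x × Good (add x t)

Repairable : Subset 7 → Set
Repairable t = Robust t centre × OneSided (add centre t)

-- Abstract so that the proofs about G* cannot unfold these decision procedures, which makes
-- type checking blow up.
abstract

  pathAdj? : ∀ i j → Dec (PathAdj i j)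
  pathAdj? i j = (suc (toℕ i) ℕ.≟ toℕ j) ⊎-dec (suc (toℕ j) ℕ.≟ toℕ i)

  dominated? : ∀ t i → Dec (Dominated t i)
  dominated? t i = any? λ j → (j ∈? t) ×-dec ((j ≟ i) ⊎-dec pathAdj? j i)

  undominated? : ∀ t i → Dec (Undominated t i)
  undominated? t i = ¬? (dominated? t i)

  freeOffCentre? : ∀ t i → Dec (FreeOffCentre t i)
  freeOffCentre? t i = ¬? (i ≟ centre) ×-dec undominated? t i

  hasFreeEdge? : ∀ {F} → Decidable F → Decidable (HasFreeEdge F)
  hasFreeEdge? F? z = F? z ×-dec any? λ u → pathAdj? z u ×-dec F? u

  legalWithin? : ∀ {F} → Decidable F → Decidable (LegalWithin F)
  legalWithin? F? x = any? λ z → ((x ≟ z) ⊎-dec pathAdj? x z) ×-dec hasFreeEdge? F? z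

  robust? : ∀ t x → Dec (Robust t x)
  robust? t = legalWithin? (freeOffCentre? t)

  possible? : ∀ t i → Dec (Possible t i)
  possible? t i = ¬? (i ∈? t) ×-dec
    (legalWithin? (undominated? t) i ⊎-dec (i ≟ centre) ⊎-dec pathAdj? i centre ×-dec undominated? t centre)

  closed? : ∀ t → Dec (Closed t)
  closed? t = dominated? t centre ×-dec ¬? (any? (hasFreeEdge? (undominated? t)))

  meetsLeft? : ∀ t → Dec (MeetsLeft t)
  meetsLeft? t = any? λ i → (i ∈? t) ×-dec (toℕ i ℕ.<? 3)

  meetsRight? : ∀ t → Dec (MeetsRight t)
  meetsRight? t = any? λ i → (i ∈? t) ×-dec (3 ℕ.<? toℕ i)

  good? : ∀ t → Dec (Good t)
  good? t = (∣ t ∣ ℕ.≟ 0)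
    ⊎-dec (∣ t ∣ ℕ.≟ 1) ×-dec dominated? t centre
    ⊎-dec (∣ t ∣ ℕ.≟ 2) ×-dec ((centre ∈? t) ⊎-dec
                                dominated? t centre ×-dec meetsLeft? t ×-dec meetsRight? t)
    ⊎-dec (∣ t ∣ ℕ.≟ 3) ×-dec (centre ∈? t) ×-dec meetsLeft? t ×-dec meetsRight? t

  oneSided? : ∀ t → Dec (OneSided t)
  oneSided? t = (3 ℕ.≤? ∣ t ∣)
    ⊎-dec (∣ t ∣ ℕ.≟ 2) ×-dec ¬? (meetsLeft? t ×-dec meetsRight? t)
    ⊎-dec (∣ t ∣ ℕ.≤? 1) ×-dec ¬? (meetsLeft? t) ×-dec ¬? (meetsRight? t)

  spare? : ∀ t → Dec (Spare t)
  spare? t = any? λ x → robust? t x ×-dec good? (add x t)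

  repairable? : ∀ t → Dec (Repairable t)
  repairable? t = robust? t centre ×-dec oneSided? (add centre t)

  good-possible : ∀ t y → Good t → Possible t y → Spare (add y t) ⊎ Good (add y t)
  good-possible = from-yes (allSubset? λ t → all? λ y →
    good? t →-dec possible? t y →-dec (spare? (add y t) ⊎-dec good? (add y t)))

  good-possible-deficit : ∀ t y → Good t → Possible t y → deficit (add y t) < deficit t
  good-possible-deficit = from-yes (allSubset? λ t → all? λ y →
    good? t →-dec possible? t y →-dec deficit (add y t) ℕ.<? deficit t)

  robust-good-deficit : ∀ t x → Robust t x → Good (add x t) → deficit (add x t) < deficit t
  robust-good-deficit = from-yes (allSubset? λ t → all? λ x →
    robust? t x →-dec good? (add x t) →-dec deficit (add x t) ℕ.<? deficit t)

  good-closed : ∀ t → Good t → ¬ Spare t → Closed t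
  good-closed = from-yes (allSubset? λ t → good? t →-dec ¬? (spare? t) →-dec closed? t)

  oneSided-possible : ∀ t y → OneSided t → Possible t y → OneSided (add y t) ⊎ Repairable (add y t)
  oneSided-possible = from-yes (allSubset? λ t → all? λ y →
    oneSided? t →-dec possible? t y →-dec (oneSided? (add y t) ⊎-dec repairable? (add y t)))

  oneSided-extend : ∀ t → OneSided t → ∣ t ∣ < 3 → ∃ λ x → Robust t x × OneSided (add x t)
  oneSided-extend = from-yes (allSubset? λ t →
    oneSided? t →-dec (∣ t ∣ ℕ.<? 3) →-dec any? λ x → robust? t x ×-dec oneSided? (add x t))

  oneSided-⊥ : OneSided ⊥
  oneSided-⊥ = from-yes (oneSided? ⊥)

  deficit-add : ∀ t y → deficit t ≤ suc (deficit (add y t))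
  deficit-add = from-yes (allSubset? λ t → all? λ y → deficit t ℕ.≤? suc (deficit (add y t)))

module _ (G : Graph) where

  private
    n = order G
    G* = Star G
    V = Fin (n * 7)

  vertex : Fin n → Fin 7 → V
  vertex = combine

  baseV-vertex : ∀ v i → baseV G (vertex v i) ≡ v
  baseV-vertex v i = cong proj₁ (remQuot-combine v i)

  pos-vertex : ∀ v i → pos G (vertex v i) ≡ i
  pos-vertex v i = cong proj₂ (remQuot-combine v i)

  coords-injective : ∀ {x y} → baseV G x ≡ baseV G y → pos G x ≡ pos G y → x ≡ y
  coords-injective {x} {y} same-base same-pos =
    trans (sym (combine-remQuot {n} 7 x)) (trans (cong₂ combine same-base same-pos) (combine-remQuot {n} 7 y))

  at-vertex : ∀ (P : Fin n → Fin 7 → Set) {v i} → P v i → P (baseV G (vertex v i)) (pos G (vertex v i))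
  at-vertex P {v} {i} = subst₂ P (sym (baseV-vertex v i)) (sym (pos-vertex v i))

  pathAdj⇒adj : ∀ {v i j} → PathAdj i j → StarAdj G (vertex v i) (vertex v j)
  pathAdj⇒adj {v} {i} {j} i~j =
    inj₁ (trans (baseV-vertex v i) (sym (baseV-vertex v j)) ,
          subst₂ PathAdj (sym (pos-vertex v i)) (sym (pos-vertex v j)) i~j)

  toℕ≡3⇒centre : ∀ {i : Fin 7} → toℕ i ≡ 3 → i ≡ centre
  toℕ≡3⇒centre = toℕ-injective

  chosenOn : List V → Fin n → Subset 7
  chosenOn []      v = ⊥
  chosenOn (a ∷ S) v with baseV G a ≟ v
  ... | yes _ = add (pos G a) (chosenOn S v)
  ... | no  _ = chosenOn S v

  chosenOn-here : ∀ a S → chosenOn (a ∷ S) (baseV G a) ≡ add (pos G a) (chosenOn S (baseV G a))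
  chosenOn-here a S with baseV G a ≟ baseV G a
  ... | yes _ = refl
  ... | no a≢a = contradiction refl a≢a

  chosenOn-elsewhere : ∀ {a S v} → baseV G a ≢ v → chosenOn (a ∷ S) v ≡ chosenOn S v
  chosenOn-elsewhere {a} {S} {v} a≢v with baseV G a ≟ v
  ... | yes a≡v = contradiction a≡v a≢v
  ... | no  _   = refl

  chosenOn-sound : ∀ {S v i} → i ∈ chosenOn S v → ∃ λ a → a ∈ₗ S × baseV G a ≡ v × pos G a ≡ i
  chosenOn-sound {[]}    i∈ = contradiction i∈ ∉⊥
  chosenOn-sound {a ∷ S} {v} i∈ with baseV G a ≟ v
  ... | no _    = map₂ (map₁ there) (chosenOn-sound i∈)
  ... | yes a≡v with x∈p∪q⁻ ⁅ pos G a ⁆ (chosenOn S v) i∈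
  ...   | inj₁ i∈⁅a⁆ = a , here refl , a≡v , sym (x∈⁅y⁆⇒x≡y (pos G a) i∈⁅a⁆)
  ...   | inj₂ i∈S   = map₂ (map₁ there) (chosenOn-sound i∈S)

  chosenOn-complete : ∀ {a S} → a ∈ₗ S → pos G a ∈ chosenOn S (baseV G a)
  chosenOn-complete {a} {a ∷ S} (here refl) =
    subst (pos G a ∈_) (sym (chosenOn-here a S)) (x∈p∪q⁺ (inj₁ (x∈⁅x⁆ (pos G a))))
  chosenOn-complete {a} {b ∷ S} (there a∈S) with baseV G b ≟ baseV G a
  ... | yes _ = x∈p∪q⁺ (inj₂ (chosenOn-complete a∈S))
  ... | no  _ = chosenOn-complete a∈S

  Every : (Subset 7 → Set) → List V → Set
  Every P S = ∀ v → P (chosenOn S v)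

  every-∷ : ∀ P {x S} → P (add (pos G x) (chosenOn S (baseV G x))) →
            (∀ v → v ≢ baseV G x → P (chosenOn S v)) → Every P (x ∷ S)
  every-∷ P {x} {S} Px Pothers = ∀≢⇒∀ (baseV G x)
    (λ v v≢x → subst P (sym (chosenOn-elsewhere (v≢x ∘ sym))) (Pothers v v≢x))
    (subst P (sym (chosenOn-here x S)) Px)

  every-∷-vertex : ∀ P {S w i} → P (add i (chosenOn S w)) →
                   (∀ v → v ≢ w → P (chosenOn S v)) → Every P (vertex w i ∷ S)
  every-∷-vertex P {S} {w} {i} Pw Pothers =
    every-∷ P (at-vertex (λ v j → P (add j (chosenOn S v))) Pw)
            (λ v v≢ → Pothers v (λ v≡w → v≢ (trans v≡w (sym (baseV-vertex w i)))))

  dominated⇒inClosedNbhd : ∀ {S x} → Dominated (chosenOn S (baseV G x)) (pos G x) → InClosedNbhd G* S x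
  dominated⇒inClosedNbhd {S} {x} (j , j∈ , j≈x) with chosenOn-sound {S} {baseV G x} j∈
  ... | a , a∈S , same-base , refl with j≈x
  ...   | inj₁ same-pos = a , a∈S , inj₁ (coords-injective same-base same-pos)
  ...   | inj₂ j~x      = a , a∈S , inj₂ (inj₁ (same-base , j~x))

  inClosedNbhd⇒dominated : ∀ {S x} → InClosedNbhd G* S x →
                           pos G x ≡ centre ⊎ Dominated (chosenOn S (baseV G x)) (pos G x)
  inClosedNbhd⇒dominated (s , s∈S , inj₁ refl) = inj₂ (pos G s , chosenOn-complete s∈S , inj₁ refl)
  inClosedNbhd⇒dominated {S} (s , s∈S , inj₂ (inj₁ (same-base , s~x))) =
    inj₂ (pos G s , subst (λ v → pos G s ∈ chosenOn S v) same-base (chosenOn-complete s∈S) , inj₂ s~x)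
  inClosedNbhd⇒dominated (s , s∈S , inj₂ (inj₂ (_ , x-centre , _))) = inj₁ (toℕ≡3⇒centre x-centre)

  free⇒undominated : ∀ {S x v} → Free G* S x → baseV G x ≡ v → Undominated (chosenOn S v) (pos G x)
  free⇒undominated free refl = free ∘ dominated⇒inClosedNbhd

  freeOffCentre⇒free : ∀ {S x} → FreeOffCentre (chosenOn S (baseV G x)) (pos G x) → Free G* S x
  freeOffCentre⇒free (x≢centre , undominated) = [ x≢centre , undominated ] ∘ inClosedNbhd⇒dominated

  robust⇒legal : ∀ {S v i} → Robust (chosenOn S v) i → Legal G* S (vertex v i)
  robust⇒legal {S} {v} {i} (z , i≈z , free-z , u , z~u , free-u) =
    vertex v z , (on-path free-z , vertex v z , vertex v u , here , step here (on-path free-u) edge , edge) , i≈z′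
    where
    on-path : ∀ {j} → FreeOffCentre (chosenOn S v) j → Free G* S (vertex v j)
    on-path = freeOffCentre⇒free ∘ at-vertex (λ w j → FreeOffCentre (chosenOn S w) j)
    edge : StarAdj G (vertex v z) (vertex v u)
    edge = pathAdj⇒adj z~u
    i≈z′ : vertex v i ≡ vertex v z ⊎ StarAdj G (vertex v i) (vertex v z)
    i≈z′ = [ inj₁ ∘ cong (vertex v) , inj₂ ∘ pathAdj⇒adj ] i≈z

  legal⇒possible : ∀ {S x} → Legal G* S x → Possible (chosenOn S (baseV G x)) (pos G x)
  legal⇒possible {S} {x} legal@(y , nontrivial@(free-y , _) , x≈y) = unchosen , witness x≈y
    where
    t = chosenOn S (baseV G x)

    unchosen : pos G x ∉ t
    unchosen x∈t with chosenOn-sound {S} {baseV G x} x∈t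
    ... | a , a∈S , same-base , same-pos =
      legal⇒unchosen G* legal (subst (_∈ₗ S) (coords-injective same-base same-pos) a∈S)

    on-path-of-x : baseV G y ≡ baseV G x → pos G x ≡ pos G y ⊎ PathAdj (pos G x) (pos G y) →
                   Witnessable t (pos G x)
    on-path-of-x same-base x≈y with nontrivial⇒freeNeighbour G* nontrivial
    ... | u , free-u , inj₁ (same-base′ , y~u) =
      inj₁ (pos G y , x≈y , free⇒undominated free-y same-base , pos G u , y~u ,
            free⇒undominated free-u (trans (sym same-base′) same-base))
    ... | u , free-u , inj₂ (y-centre , _ , _) with x≈y | toℕ≡3⇒centre y-centre
    ...   | inj₁ same-pos | y≡centre = inj₂ (inj₁ (trans same-pos y≡centre))
    ...   | inj₂ x~y      | y≡centre =
      inj₂ (inj₂ (subst (PathAdj (pos G x)) y≡centre x~y ,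
                  subst (Undominated t) y≡centre (free⇒undominated free-y same-base)))

    witness : x ≡ y ⊎ StarAdj G x y → Witnessable t (pos G x)
    witness (inj₁ refl)                      = on-path-of-x refl (inj₁ refl)
    witness (inj₂ (inj₁ (same-base , x~y)))   = on-path-of-x (sym same-base) (inj₂ x~y)
    witness (inj₂ (inj₂ (x-centre , _ , _))) = inj₂ (inj₁ (toℕ≡3⇒centre x-centre))

  closed⇒gameOver : ∀ {S} → Every Closed S → GameOver G* S
  closed⇒gameOver {S} closed x (y , nontrivial@(free-y , _) , _) with nontrivial⇒freeNeighbour G* nontrivial
  ... | u , free-u , inj₁ (same-base , y~u) =
    proj₂ (closed (baseV G y))
      (pos G y , free⇒undominated free-y refl , pos G u , y~u , free⇒undominated free-u (sym same-base))
  ... | u , free-u , inj₂ (y-centre , _ , _) =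
    free⇒undominated free-y refl
      (subst (Dominated _) (sym (toℕ≡3⇒centre y-centre)) (proj₁ (closed (baseV G y))))

  potential : List V → ℕ
  potential S = sum λ v → deficit (chosenOn S v)

  potential-[] : potential [] ≡ n * 3
  potential-[] = sum-const n 3

  potential-zero : ∀ S → (∀ v → 3 ≤ ∣ chosenOn S v ∣) → potential S ≡ 0
  potential-zero S full = sum-zero _ (m≤n⇒m∸n≡0 ∘ full)

  potential-∷-< : ∀ {x S} →
                  deficit (add (pos G x) (chosenOn S (baseV G x))) < deficit (chosenOn S (baseV G x)) →
                  potential (x ∷ S) < potential S
  potential-∷-< {x} {S} drop = sum-<-at (baseV G x)
    (λ v v≢x → cong deficit (chosenOn-elsewhere (v≢x ∘ sym)))
    (subst (λ t → deficit t < deficit (chosenOn S (baseV G x))) (sym (chosenOn-here x S)) drop)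

  potential-∷-≤ : ∀ {x S} → potential S ≤ suc (potential (x ∷ S))
  potential-∷-≤ {x} {S} = sum-≤-suc-at (baseV G x)
    (λ v v≢x → cong deficit (chosenOn-elsewhere (v≢x ∘ sym)))
    (subst (λ t → deficit (chosenOn S (baseV G x)) ≤ suc (deficit t)) (sym (chosenOn-here x S))
           (deficit-add (chosenOn S (baseV G x)) (pos G x)))

  good-move-decreases : ∀ {S y} → Every Good S → Legal G* S y → potential (y ∷ S) < potential S
  good-move-decreases {S} {y} good legal =
    potential-∷-< (good-possible-deficit (chosenOn S (baseV G y)) (pos G y) (good (baseV G y))
                                         (legal⇒possible legal))

  upperD-spare : ∀ {k S w} → Spare (chosenOn S w) → (∀ v → v ≢ w → Good (chosenOn S v)) →
                 potential S ≤ k → UpperD G* S k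
  upperD-good : ∀ {k S} → Every Good S → potential S ≤ k → UpperD G* S k
  upperS-good : ∀ {k S} → Every Good S → potential S ≤ k → UpperS G* S k
  upperD-almost : ∀ {k S w} → (∀ v → v ≢ w → Good (chosenOn S v)) →
                  Spare (chosenOn S w) ⊎ Good (chosenOn S w) → potential S ≤ k → UpperD G* S k

  upperD-spare {k} {S} {w} (i , robust , good-after) good-elsewhere = move k
    where
    x = vertex w i
    good : Every Good (x ∷ S)
    good = every-∷-vertex Good good-after good-elsewhere
    drop : potential (x ∷ S) < potential S
    drop = potential-∷-< (at-vertex (λ v j → deficit (add j (chosenOn S v)) < deficit (chosenOn S v))
                                    (robust-good-deficit (chosenOn S w) i robust good-after))
    move : ∀ k → potential S ≤ k → UpperD G* S k
    move zero    bound = contradiction (<-≤-trans drop bound) n≮0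
    move (suc k) bound = moveD x (robust⇒legal robust) (upperS-good good (≤-pred (<-≤-trans drop bound)))

  upperD-good {S = S} good with any? (λ v → spare? (chosenOn S v))
  ... | yes (w , spare) = upperD-spare spare (λ v _ → good v)
  ... | no ∄spare = λ _ →
    endD (closed⇒gameOver λ v → good-closed (chosenOn S v) (good v) (∄spare ∘ (v ,_)))

  upperS-good {zero} good bound =
    endS λ y legal → contradiction (<-≤-trans (good-move-decreases good legal) bound) n≮0
  upperS-good {suc k} {S} good bound = moveS λ y legal →
    upperD-almost {w = baseV G y} (good-elsewhere y)
      (subst (λ t → Spare t ⊎ Good t) (sym (chosenOn-here y S))
             (good-possible (chosenOn S (baseV G y)) (pos G y) (good (baseV G y)) (legal⇒possible legal)))
      (≤-pred (<-≤-trans (good-move-decreases good legal) bound))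
    where
    good-elsewhere : ∀ y v → v ≢ baseV G y → Good (chosenOn (y ∷ S) v)
    good-elsewhere y v v≢y = subst Good (sym (chosenOn-elsewhere (v≢y ∘ sym))) (good v)

  upperD-almost good-elsewhere (inj₁ spare) = upperD-spare spare good-elsewhere
  upperD-almost {w = w} good-elsewhere (inj₂ good-here) = upperD-good (∀≢⇒∀ w good-elsewhere good-here)

  oneSided-move : ∀ {S} → Every OneSided S →
                  potential S ≡ 0 ⊎ ∃ λ y → Legal G* S y × Every OneSided (y ∷ S)
  oneSided-move {S} oneSided with any? (λ v → ∣ chosenOn S v ∣ ℕ.<? 3)
  ... | no ∄short = inj₁ (potential-zero S λ v → ≮⇒≥ (∄short ∘ (v ,_)))
  ... | yes (w , short) with oneSided-extend (chosenOn S w) (oneSided w) short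
  ...   | i , robust , oneSided-after =
    inj₂ (vertex w i , robust⇒legal robust , every-∷-vertex OneSided oneSided-after (λ v _ → oneSided v))

  gameOver⇒potential≤ : ∀ {S k} → Every OneSided S → GameOver G* S → potential S ≤ k
  gameOver⇒potential≤ {k = k} oneSided over with oneSided-move oneSided
  ... | inj₁ no-potential = subst (_≤ k) (sym no-potential) z≤n
  ... | inj₂ (y , legal , _) = contradiction legal (over y)

  lowerD : ∀ {S k} → Every OneSided S → UpperD G* S k → potential S ≤ k
  lowerS : ∀ {S k} → Every OneSided S → UpperS G* S k → potential S ≤ k
  lowerS-repair : ∀ {S w k} → Repairable (chosenOn S w) → (∀ v → v ≢ w → OneSided (chosenOn S v)) →
                 UpperS G* S k → potential S ≤ k

  lowerD oneSided (endD over) = gameOver⇒potential≤ oneSided over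
  lowerD {S} oneSided (moveD x legal rest)
    with oneSided-possible (chosenOn S (baseV G x)) (pos G x) (oneSided (baseV G x)) (legal⇒possible legal)
  ... | inj₁ oneSided-after =
    ≤-trans potential-∷-≤ (s≤s (lowerS (every-∷ OneSided oneSided-after (λ v _ → oneSided v)) rest))
  ... | inj₂ repairable =
    ≤-trans potential-∷-≤ (s≤s (lowerS-repair (subst Repairable (sym (chosenOn-here x S)) repairable)
      (λ v v≢x → subst OneSided (sym (chosenOn-elsewhere (v≢x ∘ sym))) (oneSided v)) rest))

  lowerS oneSided (endS over) = gameOver⇒potential≤ oneSided over
  lowerS oneSided (moveS next) with oneSided-move oneSided
  ... | inj₁ no-potential = subst (_≤ _) (sym no-potential) z≤n
  ... | inj₂ (y , legal , oneSided-after) =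
    ≤-trans potential-∷-≤ (s≤s (lowerD oneSided-after (next y legal)))

  lowerS-repair (robust , _) _ (endS over) = contradiction (robust⇒legal robust) (over _)
  lowerS-repair (robust , oneSided-after) oneSided-elsewhere (moveS next) =
    ≤-trans potential-∷-≤ (s≤s (lowerD (every-∷-vertex OneSided oneSided-after oneSided-elsewhere)
                                       (next _ (robust⇒legal robust))))

7*[m*3]≡3*[m*7] : ∀ m → 7 * (m * 3) ≡ 3 * (m * 7)
7*[m*3]≡3*[m*7] = solve-∀

proposition3p4 : (G : Graph) →
    ∃[ k ] (7 * k ≡ 3 * order (Star G) × IsIotaG (Star G) k × IsIotaG' (Star G) k)
proposition3p4 G =
  order G * 3 ,
  7*[m*3]≡3*[m*7] (order G) ,
  (upperD-good G good-[] start , λ j → from-potential j ∘ lowerD G oneSided-[]) ,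
  (upperS-good G good-[] start , λ k → from-potential k ∘ lowerS G oneSided-[])
  where
  good-[] : Every G Good []
  good-[] _ = inj₁ refl
  oneSided-[] : Every G OneSided []
  oneSided-[] _ = oneSided-⊥
  start : potential G [] ≤ order G * 3
  start = ≤-reflexive (potential-[] G)
  from-potential : ∀ k → potential G [] ≤ k → order G * 3 ≤ k
  from-potential k = subst (_≤ k) (potential-[] G)
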